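{- Every derivation in the system $\mathcal{S}$ can be transformed into a cut-free derivation in $\mathcal{S}$ of the same sequent.
   Context: System $\mathcal{S}$: formulae are built from an infinite set of propositional letters and a constant $I$ using binary connectives $\otimes$ and $\to$. Sequents are $\Gamma\vdash A$ with $\Gamma$ a finite, possibly empty, sequence of formulae and $A$ a formula. Axioms: $A\vdash A$ and $\vdash I$. Rules ($\Gamma,\Delta,\Theta$ sequences; $A,B,C$ formulae): weakening: from $\Gamma\vdash A$ infer $I,\Gamma\vdash A$; interchange: from $\Gamma,A,B,\Delta\vdash C$ infer $\Gamma,B,A,\Delta\vdash C$; cut: from $\Gamma\vdash A$ and $\Delta,A,\Theta\vdash B$ infer $\Delta,\Gamma,\Theta\vdash B$; $(\otimes\vdash)$: from $\Gamma,A,B,\Delta\vdash C$ infer $\Gamma,A\otimes B,\Delta\vdash C$; $(\vdash\otimes)$: from $\Gamma\vdash A$ and $\Delta\vdash B$ infer $\Gamma,\Delta\vdash A\otimes B$; $(\to\vdash)$: from $\Gamma\vdash A$ and $B,\Delta\vdash C$ infer $\Gamma,A\to B,\Delta\vdash C$; $(\vdash\to)$: from $A,\Gamma\vdash B$ infer $\Gamma\vdash A\to B$. A derivation is cut-free if it contains no application of cut. -}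

module Defs where

open import Data.Nat using (ℕ)
open import Data.List using (List; []; _∷_; _++_)

infixr 6 _⊗_
infixr 5 _⇒_
data Formula : Set where
  var : ℕ → Formula
  I   : Formula
  _⊗_ : Formula → Formula → Formula
  _⇒_ : Formula → Formula → Formula

Ctx : Set
Ctx = List Formula

infix 3 _⊢_
data _⊢_ : Ctx → Formula → Set where
  ax    : ∀ {A} → (A ∷ []) ⊢ A
  ax-I  : [] ⊢ I
  weak  : ∀ {Γ A} → Γ ⊢ A → (I ∷ Γ) ⊢ A
  exch  : ∀ Γ Δ {A B C} → (Γ ++ A ∷ B ∷ Δ) ⊢ C → (Γ ++ B ∷ A ∷ Δ) ⊢ C
  cut   : ∀ Γ Δ Θ {A B} → Γ ⊢ A → (Δ ++ A ∷ Θ) ⊢ B → (Δ ++ Γ ++ Θ) ⊢ B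
  ⊗L    : ∀ Γ Δ {A B C} → (Γ ++ A ∷ B ∷ Δ) ⊢ C → (Γ ++ (A ⊗ B) ∷ Δ) ⊢ C
  ⊗R    : ∀ {Γ Δ A B} → Γ ⊢ A → Δ ⊢ B → (Γ ++ Δ) ⊢ A ⊗ B
  ⇒L    : ∀ {Γ Δ A B C} → Γ ⊢ A → (B ∷ Δ) ⊢ C → (Γ ++ (A ⇒ B) ∷ Δ) ⊢ C
  ⇒R    : ∀ {Γ A B} → (A ∷ Γ) ⊢ B → Γ ⊢ A ⇒ B

data CutFree : ∀ {Γ A} → Γ ⊢ A → Set where
  ax    : ∀ {A} → CutFree (ax {A})
  ax-I  : CutFree ax-I
  weak  : ∀ {Γ A} {d : Γ ⊢ A} → CutFree d → CutFree (weak d)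
  exch  : ∀ Γ Δ {A B C} {d : (Γ ++ A ∷ B ∷ Δ) ⊢ C} → CutFree d → CutFree (exch Γ Δ d)
  ⊗L    : ∀ Γ Δ {A B C} {d : (Γ ++ A ∷ B ∷ Δ) ⊢ C} → CutFree d → CutFree (⊗L Γ Δ d)
  ⊗R    : ∀ {Γ Δ A B} {d : Γ ⊢ A} {e : Δ ⊢ B} → CutFree d → CutFree e → CutFree (⊗R d e)
  ⇒L    : ∀ {Γ Δ A B C} {d : Γ ⊢ A} {e : (B ∷ Δ) ⊢ C} → CutFree d → CutFree e → CutFree (⇒L d e)
  ⇒R    : ∀ {Γ A B} {d : (A ∷ Γ) ⊢ B} → CutFree d → CutFree (⇒R d)

{-# OPTIONS --safe #-}
-- Cut is eliminated in an equivalent calculus _⊩_ whose sequents are taken up to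
-- permutation of the context: exchange disappears and the left rules act anywhere.
-- There Gentzen's argument goes through: permute the cut upwards in the left premise
-- until it ends in a right rule, then in the right premise until the cut formula is
-- principal, where it is replaced by cuts on its immediate subformulae.  Derivations
-- of _⊩_ are read back as cut-free derivations of S by inserting interchanges.
module Submission where

open import Defs
open import Data.Product using (Σ; ∃; _×_; _,_; map; zip)
open import Data.Sum using (_⊎_; inj₁; inj₂)
open import Data.Empty using (⊥-elim)
open import Data.List using (List; []; _∷_; _++_; [_])
open import Data.List.Properties using (++-assoc; ++-identityʳ)
open import Data.List.Membership.Propositional using (_∈_)
open import Data.List.Membership.Propositional.Properties using (∈-∃++; ∈-++⁻)
open import Data.List.Relation.Unary.Any using (here)
open import Data.List.Relation.Binary.Permutation.Propositional
  using (_↭_; refl; prep; swap; trans; ↭-refl; ↭-prep; ↭-swap; ↭-trans; ↭-sym; ↭-reflexive)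
open import Data.List.Relation.Binary.Permutation.Propositional.Properties
  using (¬x∷xs↭[]; ↭-empty-inv; ↭-singleton-inv; ∈-resp-↭; ++⁺ˡ; ++⁺ʳ; shift; shifts; drop-∷)
open import Function using (id; _∘_)
open import Relation.Binary.PropositionalEquality using (_≡_; refl; sym; subst)

module _ {a} {A : Set a} where

  ∈⇒↭∷ : ∀ {x : A} {xs} → x ∈ xs → ∃ λ ys → xs ↭ x ∷ ys
  ∈⇒↭∷ {x} x∈xs with ys , zs , refl ← ∈-∃++ x∈xs = ys ++ zs , shift x ys zs

  ∷↭++-inv : ∀ {x : A} {xs} ys zs → x ∷ xs ↭ ys ++ zs →
    (∃ λ ys′ → ys ↭ x ∷ ys′ × xs ↭ ys′ ++ zs) ⊎ (∃ λ zs′ → zs ↭ x ∷ zs′ × xs ↭ ys ++ zs′)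
  ∷↭++-inv {x} ys zs p with ∈-++⁻ ys (∈-resp-↭ p (here refl))
  ... | inj₁ x∈ys with ys′ , q ← ∈⇒↭∷ x∈ys =
    inj₁ (ys′ , q , drop-∷ (↭-trans p (++⁺ʳ zs q)))
  ... | inj₂ x∈zs with zs′ , q ← ∈⇒↭∷ x∈zs =
    inj₂ (zs′ , q , drop-∷ (↭-trans p (↭-trans (++⁺ˡ ys q) (shift x ys zs′))))

  ++⁺ˡ-shift : ∀ {x : A} xs {ys zs} → ys ↭ x ∷ zs → xs ++ ys ↭ x ∷ xs ++ zs
  ++⁺ˡ-shift {x} xs {zs = zs} p = ↭-trans (++⁺ˡ xs p) (shift x xs zs)

  ∷↭∷-inv : ∀ {x y : A} {xs ys} → x ∷ xs ↭ y ∷ ys →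
    (x ≡ y × xs ↭ ys) ⊎ (∃ λ zs → ys ↭ x ∷ zs × xs ↭ y ∷ zs)
  ∷↭∷-inv {y = y} {ys = ys} p with ∷↭++-inv [ y ] ys p
  ... | inj₁ (ys′ , q , s) with refl ← ↭-singleton-inv (↭-sym q) = inj₁ (refl , s)
  ... | inj₂ r = inj₂ r

  exchange⇒resp-↭ : ∀ {p} (P : List A → Set p) →
    (∀ Π Σ {x y} → P (Π ++ x ∷ y ∷ Σ) → P (Π ++ y ∷ x ∷ Σ)) →
    ∀ {xs ys} → xs ↭ ys → P xs → P ys
  exchange⇒resp-↭ P exchange = go []
    where
    reassoc : ∀ Π Σ {xs ys} → (P ((Π ++ Σ) ++ xs) → P ((Π ++ Σ) ++ ys)) →
              P (Π ++ Σ ++ xs) → P (Π ++ Σ ++ ys)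
    reassoc Π Σ {xs} {ys} f = subst P (++-assoc Π Σ ys) ∘ f ∘ subst P (sym (++-assoc Π Σ xs))

    go : ∀ Π {xs ys} → xs ↭ ys → P (Π ++ xs) → P (Π ++ ys)
    go Π refl         = id
    go Π (prep x p)   = reassoc Π [ x ] (go (Π ++ [ x ]) p)
    go Π (swap x y p) = reassoc Π (y ∷ x ∷ []) (go (Π ++ y ∷ x ∷ []) p) ∘ exchange Π _
    go Π (trans p q)  = go Π q ∘ go Π p

infix 3 _⊩_ _⊩ʳ_
data _⊩_ : Ctx → Formula → Set where
  ax  : ∀ {A} → [ A ] ⊩ A
  IR  : [] ⊩ I
  IL  : ∀ {Θ Γ C} → Γ ⊩ C → Θ ↭ I ∷ Γ → Θ ⊩ C
  ⊗L  : ∀ {Θ Γ A B C} → A ∷ B ∷ Γ ⊩ C → Θ ↭ A ⊗ B ∷ Γ → Θ ⊩ C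
  ⊗R  : ∀ {Θ Γ Δ A B} → Γ ⊩ A → Δ ⊩ B → Θ ↭ Γ ++ Δ → Θ ⊩ A ⊗ B
  ⇒L  : ∀ {Θ Γ Δ A B C} → Γ ⊩ A → B ∷ Δ ⊩ C → Θ ↭ (A ⇒ B) ∷ Γ ++ Δ → Θ ⊩ C
  ⇒R  : ∀ {Γ A B} → A ∷ Γ ⊩ B → Γ ⊩ A ⇒ B

data _⊩ʳ_ : Ctx → Formula → Set where
  IR  : [] ⊩ʳ I
  ⊗R  : ∀ {Θ Γ Δ A B} → Γ ⊩ A → Δ ⊩ B → Θ ↭ Γ ++ Δ → Θ ⊩ʳ A ⊗ B
  ⇒R  : ∀ {Γ A B} → A ∷ Γ ⊩ B → Γ ⊩ʳ A ⇒ B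

⊩ʳ⇒⊩ : ∀ {Γ A} → Γ ⊩ʳ A → Γ ⊩ A
⊩ʳ⇒⊩ IR         = IR
⊩ʳ⇒⊩ (⊗R d e π) = ⊗R d e π
⊩ʳ⇒⊩ (⇒R d)     = ⇒R d

⊩-resp-↭ : ∀ {Θ Θ′ C} → Θ ↭ Θ′ → Θ ⊩ C → Θ′ ⊩ C
⊩-resp-↭ q ax         with refl ← ↭-singleton-inv (↭-sym q) = ax
⊩-resp-↭ q IR         with refl ← ↭-empty-inv (↭-sym q) = IR
⊩-resp-↭ q (IL d π)   = IL d (↭-trans (↭-sym q) π)
⊩-resp-↭ q (⊗L d π)   = ⊗L d (↭-trans (↭-sym q) π)
⊩-resp-↭ q (⊗R d e π) = ⊗R d e (↭-trans (↭-sym q) π)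
⊩-resp-↭ q (⇒L d e π) = ⇒L d e (↭-trans (↭-sym q) π)
⊩-resp-↭ q (⇒R d)     = ⇒R (⊩-resp-↭ (↭-prep _ q) d)

-- The principal cuts are on proper subformulae of X; every other recursive call
-- keeps X and descends into a premise.
⊩-cut : ∀ {Γ Δ Δ′ X C} → Γ ⊩ X → Δ ⊩ C → Δ ↭ X ∷ Δ′ → Γ ++ Δ′ ⊩ C
⊩ʳ-cut : ∀ {Γ Δ Δ′ X C} → Γ ⊩ʳ X → Δ ⊩ C → Δ ↭ X ∷ Δ′ → Γ ++ Δ′ ⊩ C
⊗-principal-cut : ∀ {Γ Δ A B C} → Γ ⊩ʳ A ⊗ B → A ∷ B ∷ Δ ⊩ C → Γ ++ Δ ⊩ C
⇒-principal-cut : ∀ {Γ Δ₁ Δ₂ A B C} → Γ ⊩ʳ A ⇒ B → Δ₁ ⊩ A → B ∷ Δ₂ ⊩ C → Γ ++ Δ₁ ++ Δ₂ ⊩ C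

⊩-cut ax e p = ⊩-resp-↭ p e
⊩-cut {Δ′ = Δ′} (IL d π) e p = IL (⊩-cut d e p) (++⁺ʳ Δ′ π)
⊩-cut {Δ′ = Δ′} (⊗L d π) e p = ⊗L (⊩-cut d e p) (++⁺ʳ Δ′ π)
⊩-cut {Δ′ = Δ′} (⇒L {Γ = Γ₁} {Δ = Γ₂} d₁ d₂ π) e p =
  ⇒L d₁ (⊩-cut d₂ e p) (↭-trans (++⁺ʳ Δ′ π) (↭-prep _ (↭-reflexive (++-assoc Γ₁ Γ₂ Δ′))))
⊩-cut IR e p = ⊩ʳ-cut IR e p
⊩-cut (⊗R d₁ d₂ π) e p = ⊩ʳ-cut (⊗R d₁ d₂ π) e p
⊩-cut (⇒R d) e p = ⊩ʳ-cut (⇒R d) e p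

⊩ʳ-cut {Γ} d ax p with refl ← ↭-singleton-inv (↭-sym p) =
  ⊩-resp-↭ (↭-reflexive (sym (++-identityʳ Γ))) (⊩ʳ⇒⊩ d)
⊩ʳ-cut d IR p = ⊥-elim (¬x∷xs↭[] (↭-sym p))
⊩ʳ-cut {Γ} {Δ′ = Δ′} d (⇒R {A = A} e) p =
  ⇒R (⊩-resp-↭ (shift A Γ Δ′) (⊩ʳ-cut d e (++⁺ˡ-shift [ A ] p)))
⊩ʳ-cut {Γ} d (⊗R {Γ = Δ₁} {Δ = Δ₂} e₁ e₂ π) p with ∷↭++-inv Δ₁ Δ₂ (↭-trans (↭-sym p) π)
... | inj₁ (Δ₁′ , q , s) =
  ⊗R (⊩ʳ-cut d e₁ q) e₂ (↭-trans (++⁺ˡ Γ s) (↭-reflexive (sym (++-assoc Γ Δ₁′ Δ₂))))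
... | inj₂ (Δ₂′ , q , s) =
  ⊗R e₁ (⊩ʳ-cut d e₂ q) (↭-trans (++⁺ˡ Γ s) (shifts Γ Δ₁))
⊩ʳ-cut {Γ} d (IL e π) p with ∷↭∷-inv (↭-trans (↭-sym p) π) | d
... | inj₁ (refl , s) | IR = ⊩-resp-↭ (↭-sym s) e
... | inj₂ (Γ″ , q , s) | _ = IL (⊩ʳ-cut d e q) (++⁺ˡ-shift Γ s)
⊩ʳ-cut {Γ} d (⊗L {A = A} {B} e π) p with ∷↭∷-inv (↭-trans (↭-sym p) π)
... | inj₁ (refl , s) = ⊩-resp-↭ (++⁺ˡ Γ (↭-sym s)) (⊗-principal-cut d e)
... | inj₂ (Γ″ , q , s) =
  ⊗L (⊩-resp-↭ (shifts Γ (A ∷ B ∷ [])) (⊩ʳ-cut d e (++⁺ˡ-shift (A ∷ B ∷ []) q))) (++⁺ˡ-shift Γ s)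
⊩ʳ-cut {Γ} d (⇒L {Γ = Δ₁} {Δ = Δ₂} {B = B} e₁ e₂ π) p with ∷↭∷-inv (↭-trans (↭-sym p) π)
... | inj₁ (refl , s) = ⊩-resp-↭ (++⁺ˡ Γ (↭-sym s)) (⇒-principal-cut d e₁ e₂)
... | inj₂ (Δ₃ , q , s) with ∷↭++-inv Δ₁ Δ₂ (↭-sym q)
...   | inj₁ (Δ₁′ , q₁ , s₁) =
  ⇒L (⊩ʳ-cut d e₁ q₁) e₂
     (↭-trans (++⁺ˡ-shift Γ s) (↭-prep _ (↭-trans (++⁺ˡ Γ s₁) (↭-reflexive (sym (++-assoc Γ Δ₁′ Δ₂))))))
...   | inj₂ (Δ₂′ , q₂ , s₂) =
  ⇒L e₁ (⊩-resp-↭ (shift B Γ Δ₂′) (⊩ʳ-cut d e₂ (++⁺ˡ-shift [ B ] q₂)))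
     (↭-trans (++⁺ˡ-shift Γ s) (↭-prep _ (↭-trans (++⁺ˡ Γ s₂) (shifts Γ Δ₁))))

⊗-principal-cut {Γ} {Δ} {B = B} (⊗R {Γ = Γ₁} {Δ = Γ₂} d₁ d₂ π) e =
  ⊩-resp-↭ Γ₂Γ₁Δ↭ΓΔ (⊩-cut d₂ (⊩-cut d₁ e ↭-refl) (shift B Γ₁ Δ))
  where
  Γ₂Γ₁Δ↭ΓΔ : Γ₂ ++ Γ₁ ++ Δ ↭ Γ ++ Δ
  Γ₂Γ₁Δ↭ΓΔ = ↭-trans (shifts Γ₂ Γ₁) (↭-trans (↭-reflexive (sym (++-assoc Γ₁ Γ₂ Δ))) (++⁺ʳ Δ (↭-sym π)))

⇒-principal-cut {Γ} {Δ₁} {Δ₂} (⇒R d) e₁ e₂ =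
  ⊩-resp-↭ (↭-trans (↭-reflexive (++-assoc Δ₁ Γ Δ₂)) (shifts Δ₁ Γ)) (⊩-cut (⊩-cut e₁ d ↭-refl) e₂ ↭-refl)

infix 3 _⊢ᶜᶠ_
_⊢ᶜᶠ_ : Ctx → Formula → Set
Γ ⊢ᶜᶠ A = Σ (Γ ⊢ A) CutFree

⊢ᶜᶠ-resp-↭ : ∀ {Γ Γ′ C} → Γ ↭ Γ′ → Γ ⊢ᶜᶠ C → Γ′ ⊢ᶜᶠ C
⊢ᶜᶠ-resp-↭ {C = C} = exchange⇒resp-↭ (_⊢ᶜᶠ C) (λ Π Σ → map (exch Π Σ) (exch Π Σ))

⊩⇒⊢ᶜᶠ : ∀ {Γ C} → Γ ⊩ C → Γ ⊢ᶜᶠ C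
⊩⇒⊢ᶜᶠ ax               = ax , ax
⊩⇒⊢ᶜᶠ IR               = ax-I , ax-I
⊩⇒⊢ᶜᶠ (IL d π)         = ⊢ᶜᶠ-resp-↭ (↭-sym π) (map weak weak (⊩⇒⊢ᶜᶠ d))
⊩⇒⊢ᶜᶠ (⊗L {Γ = Γ} d π) = ⊢ᶜᶠ-resp-↭ (↭-sym π) (map (⊗L [] Γ) (⊗L [] Γ) (⊩⇒⊢ᶜᶠ d))
⊩⇒⊢ᶜᶠ (⊗R d e π)       = ⊢ᶜᶠ-resp-↭ (↭-sym π) (zip ⊗R ⊗R (⊩⇒⊢ᶜᶠ d) (⊩⇒⊢ᶜᶠ e))
⊩⇒⊢ᶜᶠ (⇒L {Γ = Γ} {Δ} d e π) =
  ⊢ᶜᶠ-resp-↭ (↭-trans (shift _ Γ Δ) (↭-sym π)) (zip ⇒L ⇒L (⊩⇒⊢ᶜᶠ d) (⊩⇒⊢ᶜᶠ e))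
⊩⇒⊢ᶜᶠ (⇒R d)           = map ⇒R ⇒R (⊩⇒⊢ᶜᶠ d)

⊢⇒⊩ : ∀ {Γ A} → Γ ⊢ A → Γ ⊩ A
⊢⇒⊩ ax                 = ax
⊢⇒⊩ ax-I               = IR
⊢⇒⊩ (weak d)           = IL (⊢⇒⊩ d) ↭-refl
⊢⇒⊩ (exch Γ Δ d)       = ⊩-resp-↭ (++⁺ˡ Γ (↭-swap _ _ ↭-refl)) (⊢⇒⊩ d)
⊢⇒⊩ (cut Γ Δ Θ {A} d e) = ⊩-resp-↭ (shifts Γ Δ) (⊩-cut (⊢⇒⊩ d) (⊢⇒⊩ e) (shift A Δ Θ))
⊢⇒⊩ (⊗L Γ Δ {A} {B} d) = ⊗L (⊩-resp-↭ (shifts Γ (A ∷ B ∷ [])) (⊢⇒⊩ d)) (shift _ Γ Δ)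
⊢⇒⊩ (⊗R d e)           = ⊗R (⊢⇒⊩ d) (⊢⇒⊩ e) ↭-refl
⊢⇒⊩ (⇒L {Γ} {Δ} d e)   = ⇒L (⊢⇒⊩ d) (⊢⇒⊩ e) (shift _ Γ Δ)
⊢⇒⊩ (⇒R d)             = ⇒R (⊢⇒⊩ d)

theorem2p5 : ∀ {Γ A} → Γ ⊢ A → Σ (Γ ⊢ A) CutFree
theorem2p5 d = ⊩⇒⊢ᶜᶠ (⊢⇒⊩ d)
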